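{- Let $D\equiv 1\pmod 4$ be a square-free positive integer of the form $D=s^2+4$ with $s$ an integer, let $F=\mathbb{Q}(\sqrt D)$, $B=\left(\frac{ -1,-1}{F}\right)$, and let $\mathcal{O}$ be the $\mathbb{Z}_F$-module generated by $1,\ i,\ \frac{\sqrt D+1}{4}+\frac{\sqrt D+3}{4}i+\frac{j}{2},\ \frac{\sqrt D+3}{4}+\frac{\sqrt D+1}{4}i+\frac{k}{2}$ (a maximal order of $B$). Let $\varepsilon=\frac{s+\sqrt D}{2}$ and $\alpha=\frac{\varepsilon}{\sqrt D}$. Then the lattice $\Lambda_{(\mathcal{O},\alpha)}$ is similar to the lattice $E_8$.
   Context: $B=\left(\frac{ -1,-1}{F}\right)$ has $F$-basis $1,i,j,k$ with $i^2=j^2=-1$, $ij=-ji=k$; $\mathbb{Z}_F=\mathbb{Z}[\frac{1+\sqrt D}{2}]$. Let $\sigma_1,\sigma_2$ be the real embeddings of $F$. For a totally positive $\alpha\in F$, $\sigma_{B,\alpha}:B\to\mathbb{R}^{8}$ sends $x+yi+zj+tk$ ($x,y,z,t\in F$) to $(\sqrt{2\sigma_1(\alpha)}\sigma_1(x),\sqrt{2\sigma_2(\alpha)}\sigma_2(x),\dots,\sqrt{2\sigma_1(\alpha)}\sigma_1(t),\sqrt{2\sigma_2(\alpha)}\sigma_2(t))$, and $\Lambda_{(\mathcal{O},\alpha)}=\sigma_{B,\alpha}(\mathcal{O})$. Two lattices are similar if one is the image of the other under an isometry composed with a scaling. $E_8$ is the unique (up to isometry) even unimodular lattice in dimension 8.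 -}

module Defs where

open import Data.Nat as ℕ using (ℕ; zero; suc)
open import Data.Nat.Divisibility using (_∣_)
open import Data.Integer as ℤ using (ℤ; +_; ∣_∣)
open import Data.Rational as ℚ using (ℚ; 0ℚ; 1ℚ)
open import Data.Fin using (Fin; zero; suc; toℕ; _≟_)
open import Data.Bool using (Bool; true; false; if_then_else_; _∨_)
open import Relation.Nullary using (yes; no)
open import Data.Product using (Σ; _×_; _,_)
open import Relation.Binary.PropositionalEquality using (_≡_)

SquareFree : ℕ → Set
SquareFree d = ∀ (n : ℕ) → n ℕ.* n ∣ d → n ≡ 1

-- D = s^2 + 4 (as a natural number; written 4 + ∣s∣² so it is visibly nonzero)
Dof : ℤ → ℕ
Dof s = suc (suc (suc (suc (∣ s ∣ ℕ.* ∣ s ∣))))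

ℤtoℚ : ℤ → ℚ
ℤtoℚ z = z ℚ./ 1

-- The field F = Q(√D): elements a + b√D with a b rational
infix 5 _+√_
record QF : Set where
  constructor _+√_
  field
    re : ℚ
    ir : ℚ
open QF public

module Field (D : ℚ) where
  _⊕_ : QF → QF → QF
  (a +√ b) ⊕ (c +√ d) = (a ℚ.+ c) +√ (b ℚ.+ d)

  _⊗_ : QF → QF → QF
  (a +√ b) ⊗ (c +√ d) = (a ℚ.* c ℚ.+ D ℚ.* (b ℚ.* d)) +√ (a ℚ.* d ℚ.+ b ℚ.* c)

  ⊖_ : QF → QF
  ⊖ (a +√ b) = ℚ.- a +√ ℚ.- b

  fromℚ : ℚ → QF
  fromℚ q = q +√ 0ℚ

  zeroF oneF sqrtD : QF
  zeroF = 0ℚ +√ 0ℚ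
  oneF  = 1ℚ +√ 0ℚ
  sqrtD = 0ℚ +√ 1ℚ

  -- Tr_{F/Q}(a + b√D) = σ₁ + σ₂ = 2a
  Tr : QF → ℚ
  Tr (a +√ b) = a ℚ.+ a

  -- Quaternion algebra B = (-1,-1 / F): x + y i + z j + t k
  record Quat : Set where
    constructor quat
    field
      q₀ q₁ q₂ q₃ : QF
  open Quat public

  _⊕q_ : Quat → Quat → Quat
  quat a b c d ⊕q quat a' b' c' d' = quat (a ⊕ a') (b ⊕ b') (c ⊕ c') (d ⊕ d')

  _·q_ : QF → Quat → Quat
  λ' ·q quat a b c d = quat (λ' ⊗ a) (λ' ⊗ b) (λ' ⊗ c) (λ' ⊗ d)

  coord : Quat → Fin 4 → QF
  coord x zero = q₀ x
  coord x (suc zero) = q₁ x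
  coord x (suc (suc zero)) = q₂ x
  coord x (suc (suc (suc zero))) = q₃ x

  -- ⟨σ_{B,α}(x), σ_{B,α}(y)⟩ = Σ_c Σ_ι 2 σ_ι(α) σ_ι(x_c) σ_ι(y_c)
  --                           = Tr_{F/Q}(2 α Σ_c x_c y_c)
  inner : QF → Quat → Quat → ℚ
  inner α x y = Tr ((fromℚ (ℤtoℚ (+ 2)) ⊗ α) ⊗
    ((((coord x zero ⊗ coord y zero) ⊕ (coord x (suc zero) ⊗ coord y (suc zero)))
      ⊕ (coord x (suc (suc zero)) ⊗ coord y (suc (suc zero))))
      ⊕ (coord x (suc (suc (suc zero))) ⊗ coord y (suc (suc (suc zero))))))

sumFin : (n : ℕ) → (Fin n → ℚ) → ℚ
sumFin zero f = 0ℚ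
sumFin (suc n) f = f zero ℚ.+ sumFin n (λ i → f (suc i))

Mat8 : Set → Set
Mat8 A = Fin 8 → Fin 8 → A

congruence : Mat8 ℤ → Mat8 ℚ → Mat8 ℚ
congruence U G r s =
  sumFin 8 λ a → sumFin 8 λ b → ℤtoℚ (U a r) ℚ.* (G a b ℚ.* ℤtoℚ (U b s))

_*ℤ_ : Mat8 ℤ → Mat8 ℤ → Mat8 ℤ
(U *ℤ V) r s = sumℤ 8 λ a → U r a ℤ.* V a s
  where
  sumℤ : (n : ℕ) → (Fin n → ℤ) → ℤ
  sumℤ zero f = + 0
  sumℤ (suc n) f = f zero ℤ.+ sumℤ n (λ i → f (suc i))

idℤ : Mat8 ℤ
idℤ r s with r ≟ s
... | yes _ = + 1
... | no _ = + 0

-- Gram matrix of E8 in a basis of simple roots (Cartan matrix of E8,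
-- Bourbaki numbering: edges 1-3, 3-4, 4-5, 5-6, 6-7, 7-8, 2-4; here 0-indexed)
adjE8 : ℕ → ℕ → Bool
adjE8 0 2 = true
adjE8 2 3 = true
adjE8 3 4 = true
adjE8 4 5 = true
adjE8 5 6 = true
adjE8 6 7 = true
adjE8 1 3 = true
adjE8 _ _ = false

gramE8 : Mat8 ℚ
gramE8 r s with r ≟ s
... | yes _ = ℤtoℚ (+ 2)
... | no _ = if adjE8 (toℕ r) (toℕ s) ∨ adjE8 (toℕ s) (toℕ r) then ℤtoℚ (ℤ.- (+ 1)) else 0ℚ

-- A lattice given by a Gram matrix G (w.r.t. some Z-basis) is similar to E8:
-- some basis change U ∈ GL₈(ℤ) turns G into c · Gram(E8) for a rational c > 0
-- (c = λ² for the scaling factor λ of the similarity).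
SimilarToE8 : Mat8 ℚ → Set
SimilarToE8 G = Σ ℚ λ c → (0ℚ ℚ.< c) × Σ (Mat8 ℤ) λ U → Σ (Mat8 ℤ) λ V →
  (∀ r s → (U *ℤ V) r s ≡ idℤ r s) × (∀ r s → congruence U G r s ≡ c ℚ.* gramE8 r s)

module Setup (s : ℤ) where
  D : ℕ
  D = Dof s

  open Field (ℤtoℚ (+ D)) public

  q : ℤ → ℕ → ℚ
  q a 0 = 0ℚ
  q a (suc b) = a ℚ./ suc b

  i j k : Quat
  i = quat zeroF oneF zeroF zeroF
  j = quat zeroF zeroF oneF zeroF
  k = quat zeroF zeroF zeroF oneF

  -- ω = (1 + √D)/2, Z_F = Z[ω]
  ω : QF
  ω = q (+ 1) 2 +√ q (+ 1) 2

  gen : Fin 4 → Quat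
  gen zero = quat oneF zeroF zeroF zeroF
  gen (suc zero) = i
  gen (suc (suc zero)) = quat (q (+ 1) 4 +√ q (+ 1) 4) (q (+ 3) 4 +√ q (+ 1) 4) (q (+ 1) 2 +√ 0ℚ) zeroF
  gen (suc (suc (suc zero))) = quat (q (+ 3) 4 +√ q (+ 1) 4) (q (+ 1) 4 +√ q (+ 1) 4) zeroF (q (+ 1) 2 +√ 0ℚ)

  -- Z-basis of 𝒪: gen m and ω · gen m  (since Z_F = Z ⊕ Z ω)
  basis : Fin 8 → Quat
  basis zero = gen zero
  basis (suc zero) = ω ·q gen zero
  basis (suc (suc zero)) = gen (suc zero)
  basis (suc (suc (suc zero))) = ω ·q gen (suc zero)
  basis (suc (suc (suc (suc zero)))) = gen (suc (suc zero))
  basis (suc (suc (suc (suc (suc zero))))) = ω ·q gen (suc (suc zero))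
  basis (suc (suc (suc (suc (suc (suc zero)))))) = gen (suc (suc (suc zero)))
  basis (suc (suc (suc (suc (suc (suc (suc zero))))))) = ω ·q gen (suc (suc (suc zero)))

  -- ε = (s + √D)/2,  α = ε/√D = ε · √D / D
  ε : QF
  ε = (s ℚ./ 2) +√ q (+ 1) 2

  α : QF
  α = fromℚ ((+ 1) ℚ./ D) ⊗ (ε ⊗ sqrtD)

  -- Gram matrix of Λ_(𝒪,α) = σ_{B,α}(𝒪) w.r.t. the Z-basis σ_{B,α}(basis r)
  gramΛ : Mat8 ℚ
  gramΛ r s' = inner α (basis r) (basis s')

-- Since D ≡ 1 (mod 4), s is odd; write s = r + 4m with r ∈ {1, 3}. Because
-- 2α = 1 + (s/D)√D, the trace form ⟨x, y⟩ = Tr_{F/Q}(2α Σ x_c y_c) sends a + b√D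
-- to 2(a + s b), and every coordinate of the Z-basis {g, ωg} of 𝒪 (g running over
-- the four Z_F-generators) is a polynomial in m. So the Gram matrix of Λ_(𝒪,α) is an
-- 8 × 8 matrix of polynomials in m with rational coefficients. For each residue r
-- an explicit U ∈ GL₈(Z[m]), given together with its inverse, satisfies
-- Uᵀ G U = Gram(E8). Both U V = I and Uᵀ G U = Gram(E8) are identities of polynomials
-- in m, checked by computing with coefficient lists and transported to every m by
-- evaluation.

module Submission where

open import Defs
open import Data.Integer using (ℤ)
open import Data.Nat using (_%_)
open import Relation.Binary.PropositionalEquality using (_≡_)

open import Algebra.Bundles using (CommutativeRing)
open import Data.Bool using (Bool; true; T; _∧_)
open import Data.Bool.Properties using (T-∧; T-≡)
open import Data.Fin using (Fin; zero; suc)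
open import Data.Fin.Patterns using (0F; 1F; 2F; 3F; 4F; 5F; 6F; 7F)
open import Data.Integer as ℤ using (+_; -[1+_])
import Data.Integer.Properties as ℤP
open import Data.Integer.Tactic.RingSolver using (solve-∀)
open import Data.List using (List; []; _∷_; map)
open import Data.Nat as ℕ using (ℕ; zero; suc)
open import Data.Nat.DivMod using (m≡m%n+[m/n]*n; [m+kn]%n≡m%n; m%n<n; %-distribˡ-*)
import Data.Nat.Properties as ℕP
open import Data.Product using (_×_; _,_; proj₁; proj₂; ∃-syntax)
open import Data.Rational as ℚ using (ℚ; 0ℚ; 1ℚ; _/_; toℚᵘ)
open import Data.Rational.Properties as ℚP
  using (toℚᵘ-injective; toℚᵘ-fromℚᵘ; toℚᵘ-homo-+; toℚᵘ-homo-*)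
open import Data.Rational.Solver using (module +-*-Solver)
open +-*-Solver using (solve; _:=_; con; _:+_; _:*_)
open import Data.Rational.Unnormalised as ℚᵘ using (mkℚᵘ; *≡*)
import Data.Rational.Unnormalised.Properties as ℚᵘP
open import Data.Sum using (_⊎_; inj₁; inj₂)
open import Data.Vec using (Vec; []; _∷_; lookup)
open import Function.Bundles using (Equivalence)
open import Relation.Binary.Definitions using (Decidable)
open import Relation.Binary.PropositionalEquality using (refl; sym; trans; cong; cong₂; subst; module ≡-Reasoning)
open import Relation.Nullary.Decidable using (isYes; toWitness)

-- i / suc k is definitionally fromℚᵘ (mkℚᵘ i k), so these are identities between integers in ℚᵘ.
ℤtoℚ-+ : ∀ a b → ℤtoℚ (a ℤ.+ b) ≡ ℤtoℚ a ℚ.+ ℤtoℚ b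
ℤtoℚ-+ a b = toℚᵘ-injective (begin
  toℚᵘ (ℤtoℚ (a ℤ.+ b))              ≈⟨ toℚᵘ-fromℚᵘ (mkℚᵘ (a ℤ.+ b) 0) ⟩
  mkℚᵘ (a ℤ.+ b) 0                   ≈⟨ *≡* (lemma a b) ⟩
  mkℚᵘ a 0 ℚᵘ.+ mkℚᵘ b 0             ≈⟨ ℚᵘP.+-cong (toℚᵘ-fromℚᵘ (mkℚᵘ a 0)) (toℚᵘ-fromℚᵘ (mkℚᵘ b 0)) ⟨
  toℚᵘ (ℤtoℚ a) ℚᵘ.+ toℚᵘ (ℤtoℚ b)   ≈⟨ toℚᵘ-homo-+ (ℤtoℚ a) (ℤtoℚ b) ⟨
  toℚᵘ (ℤtoℚ a ℚ.+ ℤtoℚ b)           ∎)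
  where
  open ℚᵘP.≃-Reasoning
  lemma : ∀ a b → (a ℤ.+ b) ℤ.* (+ 1 ℤ.* + 1) ≡ (a ℤ.* + 1 ℤ.+ b ℤ.* + 1) ℤ.* + 1
  lemma = solve-∀

ℤtoℚ-* : ∀ a b → ℤtoℚ (a ℤ.* b) ≡ ℤtoℚ a ℚ.* ℤtoℚ b
ℤtoℚ-* a b = toℚᵘ-injective (begin
  toℚᵘ (ℤtoℚ (a ℤ.* b))              ≈⟨ toℚᵘ-fromℚᵘ (mkℚᵘ (a ℤ.* b) 0) ⟩
  mkℚᵘ (a ℤ.* b) 0                   ≈⟨ *≡* (lemma a b) ⟩
  mkℚᵘ a 0 ℚᵘ.* mkℚᵘ b 0             ≈⟨ ℚᵘP.*-cong (toℚᵘ-fromℚᵘ (mkℚᵘ a 0)) (toℚᵘ-fromℚᵘ (mkℚᵘ b 0)) ⟨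
  toℚᵘ (ℤtoℚ a) ℚᵘ.* toℚᵘ (ℤtoℚ b)   ≈⟨ toℚᵘ-homo-* (ℤtoℚ a) (ℤtoℚ b) ⟨
  toℚᵘ (ℤtoℚ a ℚ.* ℤtoℚ b)           ∎)
  where
  open ℚᵘP.≃-Reasoning
  lemma : ∀ a b → (a ℤ.* b) ℤ.* (+ 1 ℤ.* + 1) ≡ (a ℤ.* b) ℤ.* + 1
  lemma = solve-∀

i/n≡i*1/n : ∀ i k → i / suc k ≡ ℤtoℚ i ℚ.* (+ 1 / suc k)
i/n≡i*1/n i k = toℚᵘ-injective (begin
  toℚᵘ (i / suc k)                       ≈⟨ toℚᵘ-fromℚᵘ (mkℚᵘ i k) ⟩
  mkℚᵘ i k                               ≈⟨ *≡* (lemma i (+ suc k)) ⟩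
  mkℚᵘ i 0 ℚᵘ.* mkℚᵘ (+ 1) k             ≈⟨ ℚᵘP.*-cong (toℚᵘ-fromℚᵘ (mkℚᵘ i 0)) (toℚᵘ-fromℚᵘ (mkℚᵘ (+ 1) k)) ⟨
  toℚᵘ (ℤtoℚ i) ℚᵘ.* toℚᵘ (+ 1 / suc k)  ≈⟨ toℚᵘ-homo-* (ℤtoℚ i) (+ 1 / suc k) ⟨
  toℚᵘ (ℤtoℚ i ℚ.* (+ 1 / suc k))        ∎)
  where
  open ℚᵘP.≃-Reasoning
  lemma : ∀ i n → i ℤ.* (+ 1 ℤ.* n) ≡ (i ℤ.* + 1) ℤ.* n
  lemma = solve-∀

1/n*n≡1 : ∀ k → (+ 1 / suc k) ℚ.* ℤtoℚ (+ suc k) ≡ 1ℚ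
1/n*n≡1 k = toℚᵘ-injective (begin
  toℚᵘ ((+ 1 / suc k) ℚ.* ℤtoℚ (+ suc k))          ≈⟨ toℚᵘ-homo-* (+ 1 / suc k) (ℤtoℚ (+ suc k)) ⟩
  toℚᵘ (+ 1 / suc k) ℚᵘ.* toℚᵘ (ℤtoℚ (+ suc k))    ≈⟨ ℚᵘP.*-cong (toℚᵘ-fromℚᵘ (mkℚᵘ (+ 1) k)) (toℚᵘ-fromℚᵘ (mkℚᵘ (+ suc k) 0)) ⟩
  mkℚᵘ (+ 1) k ℚᵘ.* mkℚᵘ (+ suc k) 0               ≈⟨ *≡* (lemma (+ suc k)) ⟩
  ℚᵘ.1ℚᵘ                                           ∎)
  where
  open ℚᵘP.≃-Reasoning
  lemma : ∀ n → (+ 1 ℤ.* n) ℤ.* + 1 ≡ + 1 ℤ.* (n ℤ.* + 1)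
  lemma = solve-∀

∣i∣*∣i∣≡i*i : ∀ i → + (ℤ.∣ i ∣ ℕ.* ℤ.∣ i ∣) ≡ i ℤ.* i
∣i∣*∣i∣≡i*i (+ n) = ℤP.pos-* n n
∣i∣*∣i∣≡i*i -[1+ n ] = refl

ℤtoℚ-Dof : ∀ s → ℤtoℚ (+ Dof s) ≡ ℤtoℚ (+ 4) ℚ.+ ℤtoℚ s ℚ.* ℤtoℚ s
ℤtoℚ-Dof s = begin
  ℤtoℚ (+ 4 ℤ.+ + (ℤ.∣ s ∣ ℕ.* ℤ.∣ s ∣)) ≡⟨ cong (λ t → ℤtoℚ (+ 4 ℤ.+ t)) (∣i∣*∣i∣≡i*i s) ⟩
  ℤtoℚ (+ 4 ℤ.+ s ℤ.* s)                 ≡⟨ ℤtoℚ-+ (+ 4) (s ℤ.* s) ⟩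
  ℤtoℚ (+ 4) ℚ.+ ℤtoℚ (s ℤ.* s)          ≡⟨ cong (ℤtoℚ (+ 4) ℚ.+_) (ℤtoℚ-* s s) ⟩
  ℤtoℚ (+ 4) ℚ.+ ℤtoℚ s ℚ.* ℤtoℚ s       ∎
  where open ≡-Reasoning

module Polynomial {c ℓ} (R : CommutativeRing c ℓ) (_≟_ : Decidable (CommutativeRing._≈_ R)) where
  open CommutativeRing R hiding (zero) renaming (refl to ≈-refl; sym to ≈-sym; trans to ≈-trans)
  open import Algebra.Properties.CommutativeSemigroup +-commutativeSemigroup using (interchange)
  open import Algebra.Properties.CommutativeSemigroup *-commutativeSemigroup using (x∙yz≈y∙xz)
  open import Relation.Binary.Reasoning.Setoid setoid

  Poly : Set c
  Poly = List Carrier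

  infixl 6 _+ₚ_
  infixl 7 _*ₚ_ _·ₚ_

  _+ₚ_ : Poly → Poly → Poly
  [] +ₚ q = q
  (a ∷ p) +ₚ [] = a ∷ p
  (a ∷ p) +ₚ (b ∷ q) = (a + b) ∷ (p +ₚ q)

  _·ₚ_ : Carrier → Poly → Poly
  a ·ₚ [] = []
  a ·ₚ (b ∷ q) = (a * b) ∷ (a ·ₚ q)

  _*ₚ_ : Poly → Poly → Poly
  [] *ₚ q = []
  (a ∷ p) *ₚ q = a ·ₚ q +ₚ (0# ∷ p *ₚ q)

  eval : Poly → Carrier → Carrier
  eval [] x = 0#
  eval (a ∷ p) x = a + x * eval p x

  eval-+ : ∀ p q x → eval (p +ₚ q) x ≈ eval p x + eval q x
  eval-+ [] q x = ≈-sym (+-identityˡ _)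
  eval-+ (a ∷ p) [] x = ≈-sym (+-identityʳ _)
  eval-+ (a ∷ p) (b ∷ q) x = begin
    (a + b) + x * eval (p +ₚ q) x         ≈⟨ +-congˡ (*-congˡ (eval-+ p q x)) ⟩
    (a + b) + x * (eval p x + eval q x)   ≈⟨ +-congˡ (distribˡ x _ _) ⟩
    (a + b) + (x * eval p x + x * eval q x) ≈⟨ interchange a b _ _ ⟩
    (a + x * eval p x) + (b + x * eval q x) ∎

  eval-· : ∀ a q x → eval (a ·ₚ q) x ≈ a * eval q x
  eval-· a [] x = ≈-sym (zeroʳ a)
  eval-· a (b ∷ q) x = begin
    a * b + x * eval (a ·ₚ q) x  ≈⟨ +-congˡ (*-congˡ (eval-· a q x)) ⟩
    a * b + x * (a * eval q x)   ≈⟨ +-congˡ (x∙yz≈y∙xz x a _) ⟩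
    a * b + a * (x * eval q x)   ≈⟨ distribˡ a _ _ ⟨
    a * (b + x * eval q x)       ∎

  eval-* : ∀ p q x → eval (p *ₚ q) x ≈ eval p x * eval q x
  eval-* [] q x = ≈-sym (zeroˡ _)
  eval-* (a ∷ p) q x = begin
    eval (a ·ₚ q +ₚ (0# ∷ p *ₚ q)) x          ≈⟨ eval-+ (a ·ₚ q) _ x ⟩
    eval (a ·ₚ q) x + (0# + x * eval (p *ₚ q) x) ≈⟨ +-cong (eval-· a q x) (+-identityˡ _) ⟩
    a * eval q x + x * eval (p *ₚ q) x         ≈⟨ +-congˡ (*-congˡ (eval-* p q x)) ⟩
    a * eval q x + x * (eval p x * eval q x)   ≈⟨ +-congˡ (*-assoc x _ _) ⟨
    a * eval q x + (x * eval p x) * eval q x   ≈⟨ distribʳ _ a _ ⟨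
    (a + x * eval p x) * eval q x              ∎

  eval-const : ∀ a x → eval (a ∷ []) x ≈ a
  eval-const a x = ≈-trans (+-congˡ (zeroʳ x)) (+-identityʳ a)

  _==ₚ_ : Poly → Poly → Bool
  [] ==ₚ [] = true
  [] ==ₚ (b ∷ q) = isYes (b ≟ 0#) ∧ ([] ==ₚ q)
  (a ∷ p) ==ₚ [] = isYes (a ≟ 0#) ∧ (p ==ₚ [])
  (a ∷ p) ==ₚ (b ∷ q) = isYes (a ≟ b) ∧ (p ==ₚ q)

  ==ₚ-sound : ∀ p q x → T (p ==ₚ q) → eval p x ≈ eval q x
  ==ₚ-sound [] [] x _ = ≈-refl
  ==ₚ-sound [] (b ∷ q) x eq with Equivalence.to T-∧ eq
  ... | b≈0 , q≈0 = begin
    0#                ≈⟨ +-identityʳ 0# ⟨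
    0# + 0#           ≈⟨ +-cong (≈-sym (toWitness b≈0)) (≈-sym (zeroʳ x)) ⟩
    b + x * 0#        ≈⟨ +-congˡ (*-congˡ (==ₚ-sound [] q x q≈0)) ⟩
    b + x * eval q x  ∎
  ==ₚ-sound (a ∷ p) [] x eq with Equivalence.to T-∧ eq
  ... | a≈0 , p≈0 = begin
    a + x * eval p x  ≈⟨ +-cong (toWitness a≈0) (*-congˡ (==ₚ-sound p [] x p≈0)) ⟩
    0# + x * 0#       ≈⟨ +-congˡ (zeroʳ x) ⟩
    0# + 0#           ≈⟨ +-identityʳ 0# ⟩
    0#                ∎
  ==ₚ-sound (a ∷ p) (b ∷ q) x eq with Equivalence.to T-∧ eq
  ... | a≈b , p≈q = +-cong (toWitness a≈b) (*-congˡ (==ₚ-sound p q x p≈q))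

  Σₚ : (n : ℕ) → (Fin n → Poly) → Poly
  Σₚ zero f = []
  Σₚ (suc n) f = f zero +ₚ Σₚ n (λ i → f (suc i))

  ∑ : (n : ℕ) → (Fin n → Carrier) → Carrier
  ∑ zero f = 0#
  ∑ (suc n) f = f zero + ∑ n (λ i → f (suc i))

  ∑-cong : ∀ n {f g : Fin n → Carrier} → (∀ i → f i ≈ g i) → ∑ n f ≈ ∑ n g
  ∑-cong zero f≈g = ≈-refl
  ∑-cong (suc n) f≈g = +-cong (f≈g zero) (∑-cong n (λ i → f≈g (suc i)))

  eval-Σ : ∀ n (f : Fin n → Poly) x → eval (Σₚ n f) x ≈ ∑ n (λ i → eval (f i) x)
  eval-Σ zero f x = ≈-refl
  eval-Σ (suc n) f x = ≈-trans (eval-+ (f zero) _ x) (+-congˡ (eval-Σ n (λ i → f (suc i)) x))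

allFin : ∀ n → (Fin n → Bool) → Bool
allFin zero f = true
allFin (suc n) f = f zero ∧ allFin n (λ i → f (suc i))

allFin-sound : ∀ n f → T (allFin n f) → ∀ i → T (f i)
allFin-sound (suc n) f h zero = proj₁ (Equivalence.to T-∧ h)
allFin-sound (suc n) f h (suc i) = allFin-sound n (λ i → f (suc i)) (proj₂ (Equivalence.to T-∧ h)) i

-- Phrased with _≡ true rather than with T so that it is discharged by refl: Agda
-- decides that conversion problem much faster than it reduces the type of tt.
HoldsEverywhere : (Fin 8 → Fin 8 → Bool) → Set
HoldsEverywhere P = allFin 8 (λ r → allFin 8 (P r)) ≡ true

holdsEverywhere-sound : ∀ P → HoldsEverywhere P → ∀ r c → T (P r c)
holdsEverywhere-sound P h r c =
  allFin-sound 8 (P r) (allFin-sound 8 (λ r → allFin 8 (P r)) (Equivalence.from T-≡ h) r) c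

module _ (d : ℚ) where
  open Field d

  fromℚ-⊗ : ∀ c a b → fromℚ c ⊗ (a +√ b) ≡ (c ℚ.* a) +√ (c ℚ.* b)
  fromℚ-⊗ c a b = cong₂ _+√_ (re-part c a b d) (ir-part c a b)
    where
    re-part : ∀ c a b d → c ℚ.* a ℚ.+ d ℚ.* (0ℚ ℚ.* b) ≡ c ℚ.* a
    re-part = solve 4 (λ c a b d → c :* a :+ d :* (con 0ℚ :* b) := c :* a) refl
    ir-part : ∀ c a b → c ℚ.* b ℚ.+ 0ℚ ℚ.* a ≡ c ℚ.* b
    ir-part = solve 3 (λ c a b → c :* b :+ con 0ℚ :* a := c :* b) refl

  ⊗-sqrtD : ∀ a b → (a +√ b) ⊗ sqrtD ≡ (d ℚ.* b) +√ a
  ⊗-sqrtD a b = cong₂ _+√_ (re-part a b d) (ir-part a b)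
    where
    re-part : ∀ a b d → a ℚ.* 0ℚ ℚ.+ d ℚ.* (b ℚ.* 1ℚ) ≡ d ℚ.* b
    re-part = solve 3 (λ a b d → a :* con 0ℚ :+ d :* (b :* con 1ℚ) := d :* b) refl
    ir-part : ∀ a b → a ℚ.* 1ℚ ℚ.+ b ℚ.* 0ℚ ≡ a
    ir-part = solve 2 (λ a b → a :* con 1ℚ :+ b :* con 0ℚ := a) refl

  dot : (Fin 4 → QF) → (Fin 4 → QF) → QF
  dot u v = (((u 0F ⊗ v 0F) ⊕ (u 1F ⊗ v 1F)) ⊕ (u 2F ⊗ v 2F)) ⊕ (u 3F ⊗ v 3F)

  dot-cong : ∀ {u u' v v'} → (∀ i → u i ≡ u' i) → (∀ i → v i ≡ v' i) → dot u v ≡ dot u' v'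
  dot-cong {u} {u'} {v} {v'} u≗u' v≗v' =
    cong₂ _⊕_ (cong₂ _⊕_ (cong₂ _⊕_ (term 0F) (term 1F)) (term 2F)) (term 3F)
    where
    term : ∀ i → u i ⊗ v i ≡ u' i ⊗ v' i
    term i = cong₂ _⊗_ (u≗u' i) (v≗v' i)

  coord-·q : ∀ c x i → coord (c ·q x) i ≡ c ⊗ coord x i
  coord-·q c x 0F = refl
  coord-·q c x 1F = refl
  coord-·q c x 2F = refl
  coord-·q c x 3F = refl

module TraceForm (s : ℤ) where
  open Setup s

  two : ℚ
  two = ℤtoℚ (+ 2)

  1/D*D≡1 : (+ 1 / D) ℚ.* ℤtoℚ (+ D) ≡ 1ℚ
  1/D*D≡1 = 1/n*n≡1 (ℕ.pred D)

  -- α = (s + √D)/(2√D) = (D + s√D)/(2D)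
  two-α : fromℚ two ⊗ α ≡ 1ℚ +√ ((+ 1 / D) ℚ.* ℤtoℚ s)
  two-α = begin
    fromℚ two ⊗ (fromℚ e ⊗ (ε ⊗ sqrtD))
      ≡⟨ cong (λ y → fromℚ two ⊗ (fromℚ e ⊗ y)) (⊗-sqrtD d (s / 2) ½) ⟩
    fromℚ two ⊗ (fromℚ e ⊗ ((d ℚ.* ½) +√ (s / 2)))
      ≡⟨ cong (fromℚ two ⊗_) (fromℚ-⊗ d e (d ℚ.* ½) (s / 2)) ⟩
    fromℚ two ⊗ ((e ℚ.* (d ℚ.* ½)) +√ (e ℚ.* (s / 2)))
      ≡⟨ fromℚ-⊗ d two (e ℚ.* (d ℚ.* ½)) (e ℚ.* (s / 2)) ⟩
    (two ℚ.* (e ℚ.* (d ℚ.* ½))) +√ (two ℚ.* (e ℚ.* (s / 2)))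
      ≡⟨ cong (λ h → (two ℚ.* (e ℚ.* (d ℚ.* ½))) +√ (two ℚ.* (e ℚ.* h))) (i/n≡i*1/n s 1) ⟩
    (two ℚ.* (e ℚ.* (d ℚ.* ½))) +√ (two ℚ.* (e ℚ.* (ℤtoℚ s ℚ.* ½)))
      ≡⟨ cong₂ _+√_ (trans (cancel-½ e d) 1/D*D≡1) (cancel-½ e (ℤtoℚ s)) ⟩
    1ℚ +√ (e ℚ.* ℤtoℚ s) ∎
    where
    open ≡-Reasoning
    d e ½ : ℚ
    d = ℤtoℚ (+ D)
    e = + 1 / D
    ½ = + 1 / 2
    cancel-½ : ∀ e y → two ℚ.* (e ℚ.* (y ℚ.* ½)) ≡ e ℚ.* y
    cancel-½ = solve 2 (λ e y → con two :* (e :* (y :* con ½)) := e :* y) refl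

  trace-2α : ∀ a b → Tr ((fromℚ two ⊗ α) ⊗ (a +√ b)) ≡ (a ℚ.+ ℤtoℚ s ℚ.* b) ℚ.+ (a ℚ.+ ℤtoℚ s ℚ.* b)
  trace-2α a b = begin
    Tr ((fromℚ two ⊗ α) ⊗ (a +√ b))        ≡⟨ cong (λ y → Tr (y ⊗ (a +√ b))) two-α ⟩
    Tr ((1ℚ +√ (e ℚ.* X)) ⊗ (a +√ b))      ≡⟨ cong (λ t → t ℚ.+ t) rational-part ⟩
    (a ℚ.+ X ℚ.* b) ℚ.+ (a ℚ.+ X ℚ.* b)    ∎
    where
    open ≡-Reasoning
    X d e : ℚ
    X = ℤtoℚ s
    d = ℤtoℚ (+ D)
    e = + 1 / D
    rearrange : ∀ a b X e d → 1ℚ ℚ.* a ℚ.+ d ℚ.* ((e ℚ.* X) ℚ.* b) ≡ a ℚ.+ (e ℚ.* d) ℚ.* (X ℚ.* b)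
    rearrange = solve 5 (λ a b X e d → con 1ℚ :* a :+ d :* ((e :* X) :* b) := a :+ (e :* d) :* (X :* b)) refl
    rational-part : 1ℚ ℚ.* a ℚ.+ d ℚ.* ((e ℚ.* X) ℚ.* b) ≡ a ℚ.+ X ℚ.* b
    rational-part = begin
      1ℚ ℚ.* a ℚ.+ d ℚ.* ((e ℚ.* X) ℚ.* b) ≡⟨ rearrange a b X e d ⟩
      a ℚ.+ (e ℚ.* d) ℚ.* (X ℚ.* b)        ≡⟨ cong (λ u → a ℚ.+ u ℚ.* (X ℚ.* b)) 1/D*D≡1 ⟩
      a ℚ.+ 1ℚ ℚ.* (X ℚ.* b)               ≡⟨ cong (a ℚ.+_) (ℚP.*-identityˡ (X ℚ.* b)) ⟩
      a ℚ.+ X ℚ.* b                        ∎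

module Pℚ = Polynomial ℚP.+-*-commutativeRing ℚP._≟_
module Pℤ = Polynomial ℤP.+-*-commutativeRing ℤP._≟_

ℤtoℚ-eval : ∀ p k → ℤtoℚ (Pℤ.eval p k) ≡ Pℚ.eval (map ℤtoℚ p) (ℤtoℚ k)
ℤtoℚ-eval [] k = refl
ℤtoℚ-eval (a ∷ p) k = begin
  ℤtoℚ (a ℤ.+ k ℤ.* Pℤ.eval p k)                        ≡⟨ ℤtoℚ-+ a (k ℤ.* Pℤ.eval p k) ⟩
  ℤtoℚ a ℚ.+ ℤtoℚ (k ℤ.* Pℤ.eval p k)                   ≡⟨ cong (ℤtoℚ a ℚ.+_) (ℤtoℚ-* k (Pℤ.eval p k)) ⟩
  ℤtoℚ a ℚ.+ ℤtoℚ k ℚ.* ℤtoℚ (Pℤ.eval p k)              ≡⟨ cong (λ t → ℤtoℚ a ℚ.+ ℤtoℚ k ℚ.* t) (ℤtoℚ-eval p k) ⟩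
  ℤtoℚ a ℚ.+ ℤtoℚ k ℚ.* Pℚ.eval (map ℤtoℚ p) (ℤtoℚ k)   ∎
  where open ≡-Reasoning

linear-eval : ∀ a b m → a ℤ.+ b ℤ.* m ≡ Pℤ.eval (a ∷ b ∷ []) m
linear-eval = lemma
  where
  lemma : ∀ a b m → a ℤ.+ b ℤ.* m ≡ a ℤ.+ m ℤ.* (b ℤ.+ m ℤ.* + 0)
  lemma = solve-∀

evalMat : ℤ → Mat8 Pℤ.Poly → Mat8 ℤ
evalMat m U a r = Pℤ.eval (U a r) m

productₚ : Mat8 Pℤ.Poly → Mat8 Pℤ.Poly → Mat8 Pℤ.Poly
productₚ U V r c = Pℤ.Σₚ 8 λ a → U r a Pℤ.*ₚ V a c

product-eval : ∀ m U V r c → (evalMat m U *ℤ evalMat m V) r c ≡ Pℤ.eval (productₚ U V r c) m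
product-eval m U V r c = sym (trans (Pℤ.eval-Σ 8 (λ a → U r a Pℤ.*ₚ V a c) m)
  (Pℤ.∑-cong 8 λ a → Pℤ.eval-* (U r a) (V a c) m))

inverse-check : Mat8 Pℤ.Poly → Mat8 Pℤ.Poly → Fin 8 → Fin 8 → Bool
inverse-check U V r c = productₚ U V r c Pℤ.==ₚ (idℤ r c ∷ [])

module Symbolic (s m : ℤ) (sₚ : Pℤ.Poly) (s≡sₚ[m] : s ≡ Pℤ.eval sₚ m) where
  open Setup s using (D; ω; gen; basis; α; gramΛ)
  open Field (ℤtoℚ (+ D))
  open TraceForm s using (two; trace-2α)
  open Pℚ
  open ≡-Reasoning

  x : ℚ
  x = ℤtoℚ m

  Sₚ Dₚ : Poly
  Sₚ = map ℤtoℚ sₚ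
  Dₚ = (ℤtoℚ (+ 4) ∷ []) +ₚ Sₚ *ₚ Sₚ

  s-eval : ℤtoℚ s ≡ eval Sₚ x
  s-eval = trans (cong ℤtoℚ s≡sₚ[m]) (ℤtoℚ-eval sₚ m)

  D-eval : ℤtoℚ (+ D) ≡ eval Dₚ x
  D-eval = begin
    ℤtoℚ (+ D)                                      ≡⟨ ℤtoℚ-Dof s ⟩
    ℤtoℚ (+ 4) ℚ.+ ℤtoℚ s ℚ.* ℤtoℚ s                ≡⟨ cong (λ t → ℤtoℚ (+ 4) ℚ.+ t ℚ.* t) s-eval ⟩
    ℤtoℚ (+ 4) ℚ.+ eval Sₚ x ℚ.* eval Sₚ x          ≡⟨ cong₂ ℚ._+_ (sym (eval-const (ℤtoℚ (+ 4)) x)) (sym (eval-* Sₚ Sₚ x)) ⟩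
    eval (ℤtoℚ (+ 4) ∷ []) x ℚ.+ eval (Sₚ *ₚ Sₚ) x  ≡⟨ sym (eval-+ (ℤtoℚ (+ 4) ∷ []) (Sₚ *ₚ Sₚ) x) ⟩
    eval Dₚ x                                       ∎

  -- An element of F whose rational coordinates are polynomials in m.
  Fₚ : Set
  Fₚ = Poly × Poly

  ⟦_⟧ : Fₚ → QF
  ⟦ p , q ⟧ = eval p x +√ eval q x

  infixl 6 _⊕ₚ_
  infixl 7 _⊗ₚ_

  _⊕ₚ_ _⊗ₚ_ : Fₚ → Fₚ → Fₚ
  (a , b) ⊕ₚ (c , d) = a +ₚ c , b +ₚ d
  (a , b) ⊗ₚ (c , d) = a *ₚ c +ₚ Dₚ *ₚ (b *ₚ d) , a *ₚ d +ₚ b *ₚ c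

  constₚ : QF → Fₚ
  constₚ z = re z ∷ [] , ir z ∷ []

  ⟦⊕⟧ : ∀ y z → ⟦ y ⊕ₚ z ⟧ ≡ ⟦ y ⟧ ⊕ ⟦ z ⟧
  ⟦⊕⟧ (a , b) (c , d) = cong₂ _+√_ (eval-+ a c x) (eval-+ b d x)

  ⟦⊗⟧ : ∀ y z → ⟦ y ⊗ₚ z ⟧ ≡ ⟦ y ⟧ ⊗ ⟦ z ⟧
  ⟦⊗⟧ (a , b) (c , d) = cong₂ _+√_
    (trans (eval-+ (a *ₚ c) _ x) (cong₂ ℚ._+_ (eval-* a c x)
      (trans (eval-* Dₚ _ x) (cong₂ ℚ._*_ (sym D-eval) (eval-* b d x)))))
    (trans (eval-+ (a *ₚ d) _ x) (cong₂ ℚ._+_ (eval-* a d x) (eval-* b c x)))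

  ⟦const⟧ : ∀ z → ⟦ constₚ z ⟧ ≡ z
  ⟦const⟧ z = cong₂ _+√_ (eval-const (re z) x) (eval-const (ir z) x)

  dotₚ : (Fin 4 → Fₚ) → (Fin 4 → Fₚ) → Fₚ
  dotₚ u v = u 0F ⊗ₚ v 0F ⊕ₚ u 1F ⊗ₚ v 1F
    ⊕ₚ u 2F ⊗ₚ v 2F ⊕ₚ u 3F ⊗ₚ v 3F

  ⟦dot⟧ : ∀ u v → ⟦ dotₚ u v ⟧ ≡ dot (ℤtoℚ (+ D)) (λ i → ⟦ u i ⟧) (λ i → ⟦ v i ⟧)
  ⟦dot⟧ u v =
    trans (⟦⊕⟧ (p 0F ⊕ₚ p 1F ⊕ₚ p 2F) (p 3F)) (cong₂ _⊕_
      (trans (⟦⊕⟧ (p 0F ⊕ₚ p 1F) (p 2F)) (cong₂ _⊕_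
        (trans (⟦⊕⟧ (p 0F) (p 1F)) (cong₂ _⊕_ (term 0F) (term 1F)))
        (term 2F)))
      (term 3F))
    where
    p : Fin 4 → Fₚ
    p i = u i ⊗ₚ v i
    term : ∀ i → ⟦ p i ⟧ ≡ ⟦ u i ⟧ ⊗ ⟦ v i ⟧
    term i = ⟦⊗⟧ (u i) (v i)

  Trₚ : Fₚ → Poly
  Trₚ (p , q) = (p +ₚ Sₚ *ₚ q) +ₚ (p +ₚ Sₚ *ₚ q)

  trace-eval : ∀ z → Tr ((fromℚ two ⊗ α) ⊗ ⟦ z ⟧) ≡ eval (Trₚ z) x
  trace-eval (p , q) = begin
    Tr ((fromℚ two ⊗ α) ⊗ (eval p x +√ eval q x))
      ≡⟨ trace-2α (eval p x) (eval q x) ⟩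
    (eval p x ℚ.+ ℤtoℚ s ℚ.* eval q x) ℚ.+ (eval p x ℚ.+ ℤtoℚ s ℚ.* eval q x)
      ≡⟨ cong (λ t → t ℚ.+ t) linear ⟩
    eval (p +ₚ Sₚ *ₚ q) x ℚ.+ eval (p +ₚ Sₚ *ₚ q) x
      ≡⟨ sym (eval-+ (p +ₚ Sₚ *ₚ q) (p +ₚ Sₚ *ₚ q) x) ⟩
    eval (Trₚ (p , q)) x ∎
    where
    linear : eval p x ℚ.+ ℤtoℚ s ℚ.* eval q x ≡ eval (p +ₚ Sₚ *ₚ q) x
    linear = begin
      eval p x ℚ.+ ℤtoℚ s ℚ.* eval q x     ≡⟨ cong (λ t → eval p x ℚ.+ t ℚ.* eval q x) s-eval ⟩
      eval p x ℚ.+ eval Sₚ x ℚ.* eval q x  ≡⟨ cong (eval p x ℚ.+_) (sym (eval-* Sₚ q x)) ⟩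
      eval p x ℚ.+ eval (Sₚ *ₚ q) x        ≡⟨ sym (eval-+ p (Sₚ *ₚ q) x) ⟩
      eval (p +ₚ Sₚ *ₚ q) x                ∎

  liftₚ : Quat → Fin 4 → Fₚ
  liftₚ y i = constₚ (coord y i)

  ω·liftₚ : Quat → Fin 4 → Fₚ
  ω·liftₚ y i = constₚ ω ⊗ₚ liftₚ y i

  basisₚ : Fin 8 → Fin 4 → Fₚ
  basisₚ 0F = liftₚ (gen 0F)
  basisₚ 1F = ω·liftₚ (gen 0F)
  basisₚ 2F = liftₚ (gen 1F)
  basisₚ 3F = ω·liftₚ (gen 1F)
  basisₚ 4F = liftₚ (gen 2F)
  basisₚ 5F = ω·liftₚ (gen 2F)
  basisₚ 6F = liftₚ (gen 3F)
  basisₚ 7F = ω·liftₚ (gen 3F)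

  coord-lift : ∀ y i → coord y i ≡ ⟦ liftₚ y i ⟧
  coord-lift y i = sym (⟦const⟧ (coord y i))

  coord-ω·lift : ∀ y i → coord (ω ·q y) i ≡ ⟦ ω·liftₚ y i ⟧
  coord-ω·lift y i = begin
    coord (ω ·q y) i                  ≡⟨ coord-·q (ℤtoℚ (+ D)) ω y i ⟩
    ω ⊗ coord y i                     ≡⟨ cong₂ _⊗_ (sym (⟦const⟧ ω)) (coord-lift y i) ⟩
    ⟦ constₚ ω ⟧ ⊗ ⟦ liftₚ y i ⟧      ≡⟨ sym (⟦⊗⟧ (constₚ ω) (liftₚ y i)) ⟩
    ⟦ ω·liftₚ y i ⟧                   ∎

  coord-basis : ∀ r i → coord (basis r) i ≡ ⟦ basisₚ r i ⟧
  coord-basis 0F = coord-lift (gen 0F)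
  coord-basis 1F = coord-ω·lift (gen 0F)
  coord-basis 2F = coord-lift (gen 1F)
  coord-basis 3F = coord-ω·lift (gen 1F)
  coord-basis 4F = coord-lift (gen 2F)
  coord-basis 5F = coord-ω·lift (gen 2F)
  coord-basis 6F = coord-lift (gen 3F)
  coord-basis 7F = coord-ω·lift (gen 3F)

  gramₚ : Fin 8 → Fin 8 → Poly
  gramₚ r c = Trₚ (dotₚ (basisₚ r) (basisₚ c))

  gram-eval : ∀ r c → gramΛ r c ≡ eval (gramₚ r c) x
  gram-eval r c = begin
    gramΛ r c
      ≡⟨⟩
    Tr ((fromℚ two ⊗ α) ⊗ dot (ℤtoℚ (+ D)) (coord (basis r)) (coord (basis c)))
      ≡⟨ cong (λ z → Tr ((fromℚ two ⊗ α) ⊗ z)) symbolic-dot ⟩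
    Tr ((fromℚ two ⊗ α) ⊗ ⟦ dotₚ (basisₚ r) (basisₚ c) ⟧)
      ≡⟨ trace-eval (dotₚ (basisₚ r) (basisₚ c)) ⟩
    eval (gramₚ r c) x ∎
    where
    symbolic-dot : dot (ℤtoℚ (+ D)) (coord (basis r)) (coord (basis c)) ≡ ⟦ dotₚ (basisₚ r) (basisₚ c) ⟧
    symbolic-dot = trans (dot-cong (ℤtoℚ (+ D)) (coord-basis r) (coord-basis c)) (sym (⟦dot⟧ (basisₚ r) (basisₚ c)))

  congruenceₚ : Mat8 Pℤ.Poly → Fin 8 → Fin 8 → Poly
  congruenceₚ U r c = Σₚ 8 λ a → Σₚ 8 λ b → map ℤtoℚ (U a r) *ₚ (gramₚ a b *ₚ map ℤtoℚ (U b c))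

  congruence-eval : ∀ U r c → congruence (evalMat m U) gramΛ r c ≡ eval (congruenceₚ U r c) x
  congruence-eval U r c = sym (trans (eval-Σ 8 row x) (∑-cong 8 λ a → trans (eval-Σ 8 (term a) x) (∑-cong 8 (entry a))))
    where
    term : Fin 8 → Fin 8 → Poly
    term a b = map ℤtoℚ (U a r) *ₚ (gramₚ a b *ₚ map ℤtoℚ (U b c))
    row : Fin 8 → Poly
    row a = Σₚ 8 (term a)
    entry : ∀ a b → eval (term a b) x ≡ ℤtoℚ (evalMat m U a r) ℚ.* (gramΛ a b ℚ.* ℤtoℚ (evalMat m U b c))
    entry a b = begin
      eval (map ℤtoℚ (U a r) *ₚ (gramₚ a b *ₚ map ℤtoℚ (U b c))) x
        ≡⟨ eval-* (map ℤtoℚ (U a r)) _ x ⟩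
      eval (map ℤtoℚ (U a r)) x ℚ.* eval (gramₚ a b *ₚ map ℤtoℚ (U b c)) x
        ≡⟨ cong (eval (map ℤtoℚ (U a r)) x ℚ.*_) (eval-* (gramₚ a b) (map ℤtoℚ (U b c)) x) ⟩
      eval (map ℤtoℚ (U a r)) x ℚ.* (eval (gramₚ a b) x ℚ.* eval (map ℤtoℚ (U b c)) x)
        ≡⟨ sym (cong₂ (λ u w → u ℚ.* w) (ℤtoℚ-eval (U a r) m)
                 (cong₂ ℚ._*_ (gram-eval a b) (ℤtoℚ-eval (U b c) m))) ⟩
      ℤtoℚ (evalMat m U a r) ℚ.* (gramΛ a b ℚ.* ℤtoℚ (evalMat m U b c)) ∎

  E8-check : Mat8 Pℤ.Poly → Fin 8 → Fin 8 → Bool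
  E8-check U r c = congruenceₚ U r c ==ₚ (gramE8 r c ∷ [])

  similar-by-certificate : (U V : Mat8 Pℤ.Poly)
    → HoldsEverywhere (inverse-check U V)
    → HoldsEverywhere (E8-check U)
    → SimilarToE8 gramΛ
  similar-by-certificate U V inverse congruent =
    1ℚ , ℚP.positive⁻¹ 1ℚ , evalMat m U , evalMat m V , U*V≡I , UᵀGU≡E8
    where
    U*V≡I : ∀ r c → (evalMat m U *ℤ evalMat m V) r c ≡ idℤ r c
    U*V≡I r c = begin
      (evalMat m U *ℤ evalMat m V) r c    ≡⟨ product-eval m U V r c ⟩
      Pℤ.eval (productₚ U V r c) m        ≡⟨ Pℤ.==ₚ-sound (productₚ U V r c) (idℤ r c ∷ []) m (holdsEverywhere-sound (inverse-check U V) inverse r c) ⟩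
      Pℤ.eval (idℤ r c ∷ []) m            ≡⟨ Pℤ.eval-const (idℤ r c) m ⟩
      idℤ r c                             ∎
    UᵀGU≡E8 : ∀ r c → congruence (evalMat m U) gramΛ r c ≡ 1ℚ ℚ.* gramE8 r c
    UᵀGU≡E8 r c = begin
      congruence (evalMat m U) gramΛ r c  ≡⟨ congruence-eval U r c ⟩
      eval (congruenceₚ U r c) x          ≡⟨ ==ₚ-sound (congruenceₚ U r c) (gramE8 r c ∷ []) x (holdsEverywhere-sound (E8-check U) congruent r c) ⟩
      eval (gramE8 r c ∷ []) x            ≡⟨ eval-const (gramE8 r c) x ⟩
      gramE8 r c                          ≡⟨ sym (ℚP.*-identityˡ (gramE8 r c)) ⟩
      1ℚ ℚ.* gramE8 r c                   ∎

Odd : ℤ → Set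
Odd s = ∃[ m ] (s ≡ + 1 ℤ.+ + 4 ℤ.* m ⊎ s ≡ + 3 ℤ.+ + 4 ℤ.* m)

n²+4≡1[4]⇒n≡±1[4] : ∀ n → (4 ℕ.+ n ℕ.* n) % 4 ≡ 1 → n % 4 ≡ 1 ⊎ n % 4 ≡ 3
n²+4≡1[4]⇒n≡±1[4] n h = residue (n % 4) (m%n<n n 4) (trans (sym square%4) h)
  where
  square%4 : (4 ℕ.+ n ℕ.* n) % 4 ≡ ((n % 4) ℕ.* (n % 4)) % 4
  square%4 = trans (cong (_% 4) (ℕP.+-comm 4 (n ℕ.* n)))
    (trans ([m+kn]%n≡m%n (n ℕ.* n) 1 4) (%-distribˡ-* n n 4))
  residue : ∀ r → r ℕ.< 4 → (r ℕ.* r) % 4 ≡ 1 → r ≡ 1 ⊎ r ≡ 3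
  residue 0 _ ()
  residue 1 _ _ = inj₁ refl
  residue 2 _ ()
  residue 3 _ _ = inj₂ refl
  residue (suc (suc (suc (suc _)))) (ℕ.s≤s (ℕ.s≤s (ℕ.s≤s (ℕ.s≤s ())))) _

n≡r+4[n/4] : ∀ {n r} → n % 4 ≡ r → + n ≡ + r ℤ.+ + 4 ℤ.* + (n ℕ./ 4)
n≡r+4[n/4] {n} refl = begin
  + n                                  ≡⟨ cong +_ (m≡m%n+[m/n]*n n 4) ⟩
  + (n % 4 ℕ.+ (n ℕ./ 4) ℕ.* 4)        ≡⟨ ℤP.pos-+ (n % 4) ((n ℕ./ 4) ℕ.* 4) ⟩
  + (n % 4) ℤ.+ + ((n ℕ./ 4) ℕ.* 4)    ≡⟨ cong (λ t → + (n % 4) ℤ.+ t) (ℤP.pos-* (n ℕ./ 4) 4) ⟩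
  + (n % 4) ℤ.+ + (n ℕ./ 4) ℤ.* + 4    ≡⟨ cong (λ t → + (n % 4) ℤ.+ t) (ℤP.*-comm (+ (n ℕ./ 4)) (+ 4)) ⟩
  + (n % 4) ℤ.+ + 4 ℤ.* + (n ℕ./ 4)    ∎
  where open ≡-Reasoning

odd-+ : ∀ n → n % 4 ≡ 1 ⊎ n % 4 ≡ 3 → Odd (+ n)
odd-+ n (inj₁ n≡1) = + (n ℕ./ 4) , inj₁ (n≡r+4[n/4] n≡1)
odd-+ n (inj₂ n≡3) = + (n ℕ./ 4) , inj₂ (n≡r+4[n/4] n≡3)

odd-neg : ∀ s → Odd s → Odd (ℤ.- s)
odd-neg s (m , inj₁ s≡1+4m) = ℤ.- (+ 1 ℤ.+ m) , inj₂ (trans (cong ℤ.-_ s≡1+4m) (lemma m))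
  where
  lemma : ∀ m → ℤ.- (+ 1 ℤ.+ + 4 ℤ.* m) ≡ + 3 ℤ.+ + 4 ℤ.* ℤ.- (+ 1 ℤ.+ m)
  lemma = solve-∀
odd-neg s (m , inj₂ s≡3+4m) = ℤ.- (+ 1 ℤ.+ m) , inj₁ (trans (cong ℤ.-_ s≡3+4m) (lemma m))
  where
  lemma : ∀ m → ℤ.- (+ 3 ℤ.+ + 4 ℤ.* m) ≡ + 1 ℤ.+ + 4 ℤ.* ℤ.- (+ 1 ℤ.+ m)
  lemma = solve-∀

D≡1[4]⇒odd : ∀ s → Dof s % 4 ≡ 1 → Odd s
D≡1[4]⇒odd (+ n) h = odd-+ n (n²+4≡1[4]⇒n≡±1[4] n h)
D≡1[4]⇒odd -[1+ n ] h = odd-neg (+ suc n) (odd-+ (suc n) (n²+4≡1[4]⇒n≡±1[4] (suc n) h))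

fromRows : ∀ {A : Set} → Vec (Vec A 8) 8 → Mat8 A
fromRows rows r c = lookup (lookup rows r) c

module Certificates where
  open import Agda.Builtin.FromNat using (fromNat)
  open import Agda.Builtin.FromNeg using (fromNeg)
  open import Data.Integer.Literals using (number; negative)
  open import Data.Unit using (tt)

  instance
    ℤ-number = number
    ℤ-negative = negative

  U₁ : Mat8 Pℤ.Poly
  U₁ = fromRows
    ( ((0 ∷ 1 ∷ -2 ∷ []) ∷ (-2 ∷ -2 ∷ -2 ∷ []) ∷ (0 ∷ -1 ∷ []) ∷ (1 ∷ 1 ∷ 2 ∷ []) ∷ (0 ∷ 0 ∷ -2 ∷ []) ∷ (0 ∷ 1 ∷ 4 ∷ []) ∷ (0 ∷ -1 ∷ -2 ∷ []) ∷ (0 ∷ 0 ∷ -2 ∷ []) ∷ [])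
    ∷ ((-2 ∷ 1 ∷ []) ∷ (0 ∷ 1 ∷ []) ∷ (1 ∷ []) ∷ (0 ∷ -1 ∷ []) ∷ (0 ∷ 1 ∷ []) ∷ (0 ∷ -2 ∷ []) ∷ (0 ∷ 1 ∷ []) ∷ (0 ∷ 1 ∷ []) ∷ [])
    ∷ ((-1 ∷ -1 ∷ -2 ∷ []) ∷ (0 ∷ 0 ∷ -2 ∷ []) ∷ (0 ∷ 1 ∷ []) ∷ (1 ∷ 1 ∷ 2 ∷ []) ∷ (-1 ∷ -2 ∷ -2 ∷ []) ∷ (0 ∷ 1 ∷ 4 ∷ []) ∷ (0 ∷ -1 ∷ -2 ∷ []) ∷ (0 ∷ 0 ∷ -2 ∷ []) ∷ [])
    ∷ ((-1 ∷ 1 ∷ []) ∷ (-1 ∷ 1 ∷ []) ∷ [] ∷ (0 ∷ -1 ∷ []) ∷ (1 ∷ 1 ∷ []) ∷ (0 ∷ -2 ∷ []) ∷ (0 ∷ 1 ∷ []) ∷ (0 ∷ 1 ∷ []) ∷ [])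
    ∷ ((1 ∷ []) ∷ (-1 ∷ -2 ∷ []) ∷ [] ∷ [] ∷ (-1 ∷ []) ∷ (2 ∷ 2 ∷ []) ∷ [] ∷ (-1 ∷ -2 ∷ []) ∷ [])
    ∷ ([] ∷ (1 ∷ []) ∷ [] ∷ [] ∷ [] ∷ (-1 ∷ []) ∷ [] ∷ (1 ∷ []) ∷ [])
    ∷ ((0 ∷ -2 ∷ []) ∷ (1 ∷ []) ∷ (-1 ∷ []) ∷ (1 ∷ 2 ∷ []) ∷ (-1 ∷ -2 ∷ []) ∷ (1 ∷ 2 ∷ []) ∷ (-1 ∷ -2 ∷ []) ∷ (-1 ∷ []) ∷ [])
    ∷ ((1 ∷ []) ∷ [] ∷ [] ∷ (-1 ∷ []) ∷ (1 ∷ []) ∷ (-1 ∷ []) ∷ (1 ∷ []) ∷ [] ∷ [])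
    ∷ [])

  V₁ : Mat8 Pℤ.Poly
  V₁ = fromRows
    ( ((1 ∷ []) ∷ (1 ∷ 2 ∷ []) ∷ (-1 ∷ []) ∷ (0 ∷ -2 ∷ []) ∷ (1 ∷ []) ∷ (2 ∷ 1 ∷ []) ∷ (1 ∷ []) ∷ (1 ∷ 1 ∷ []) ∷ [])
    ∷ ((1 ∷ []) ∷ (2 ∷ 2 ∷ []) ∷ (-1 ∷ []) ∷ (1 ∷ -2 ∷ []) ∷ (2 ∷ []) ∷ (4 ∷ 1 ∷ []) ∷ (2 ∷ []) ∷ (2 ∷ 1 ∷ []) ∷ [])
    ∷ ((2 ∷ []) ∷ (3 ∷ 4 ∷ []) ∷ (-2 ∷ []) ∷ (0 ∷ -4 ∷ []) ∷ (2 ∷ []) ∷ (4 ∷ 1 ∷ []) ∷ (2 ∷ []) ∷ (2 ∷ 1 ∷ []) ∷ [])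
    ∷ ((3 ∷ []) ∷ (4 ∷ 6 ∷ []) ∷ (-2 ∷ []) ∷ (2 ∷ -4 ∷ []) ∷ (4 ∷ 1 ∷ []) ∷ (8 ∷ 4 ∷ 2 ∷ []) ∷ (4 ∷ 1 ∷ []) ∷ (4 ∷ 4 ∷ 2 ∷ []) ∷ [])
    ∷ ((2 ∷ []) ∷ (3 ∷ 4 ∷ []) ∷ (-2 ∷ []) ∷ (2 ∷ -4 ∷ []) ∷ (3 ∷ []) ∷ (6 ∷ 1 ∷ []) ∷ (3 ∷ []) ∷ (3 ∷ 1 ∷ []) ∷ [])
    ∷ ((1 ∷ []) ∷ (2 ∷ 2 ∷ []) ∷ (-1 ∷ []) ∷ (2 ∷ -2 ∷ []) ∷ (3 ∷ []) ∷ (5 ∷ 2 ∷ []) ∷ (2 ∷ []) ∷ (2 ∷ []) ∷ [])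
    ∷ ((1 ∷ []) ∷ (2 ∷ 2 ∷ []) ∷ [] ∷ (2 ∷ []) ∷ (3 ∷ 1 ∷ []) ∷ (5 ∷ 4 ∷ 2 ∷ []) ∷ (2 ∷ 1 ∷ []) ∷ (3 ∷ 2 ∷ 2 ∷ []) ∷ [])
    ∷ ([] ∷ [] ∷ [] ∷ (1 ∷ []) ∷ (1 ∷ []) ∷ (2 ∷ 1 ∷ []) ∷ [] ∷ (0 ∷ -1 ∷ []) ∷ [])
    ∷ [])

  U₃ : Mat8 Pℤ.Poly
  U₃ = fromRows
    ( ((2 ∷ 4 ∷ 2 ∷ []) ∷ (-2 ∷ -3 ∷ -2 ∷ []) ∷ (-3 ∷ -6 ∷ -4 ∷ []) ∷ (2 ∷ 5 ∷ 4 ∷ []) ∷ (0 ∷ -2 ∷ -2 ∷ []) ∷ [] ∷ (0 ∷ 2 ∷ 2 ∷ []) ∷ (1 ∷ []) ∷ [])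
    ∷ ((-2 ∷ -1 ∷ []) ∷ (0 ∷ 1 ∷ []) ∷ (1 ∷ 2 ∷ []) ∷ (0 ∷ -2 ∷ []) ∷ (0 ∷ 1 ∷ []) ∷ [] ∷ (0 ∷ -1 ∷ []) ∷ [] ∷ [])
    ∷ ((0 ∷ 2 ∷ 2 ∷ []) ∷ (0 ∷ -1 ∷ -2 ∷ []) ∷ (-3 ∷ -6 ∷ -4 ∷ []) ∷ (2 ∷ 5 ∷ 4 ∷ []) ∷ (0 ∷ -2 ∷ -2 ∷ []) ∷ [] ∷ (1 ∷ 2 ∷ 2 ∷ []) ∷ (-1 ∷ []) ∷ [])
    ∷ ((-1 ∷ -1 ∷ []) ∷ (-1 ∷ 1 ∷ []) ∷ (1 ∷ 2 ∷ []) ∷ (0 ∷ -2 ∷ []) ∷ (0 ∷ 1 ∷ []) ∷ [] ∷ (0 ∷ -1 ∷ []) ∷ [] ∷ [])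
    ∷ ((3 ∷ 2 ∷ []) ∷ (-2 ∷ -2 ∷ []) ∷ (-2 ∷ -2 ∷ []) ∷ (2 ∷ 2 ∷ []) ∷ [] ∷ (-2 ∷ -2 ∷ []) ∷ (1 ∷ 2 ∷ []) ∷ (1 ∷ []) ∷ [])
    ∷ ((-1 ∷ []) ∷ (1 ∷ []) ∷ (1 ∷ []) ∷ (-1 ∷ []) ∷ [] ∷ (1 ∷ []) ∷ (-1 ∷ []) ∷ [] ∷ [])
    ∷ ((1 ∷ []) ∷ (1 ∷ []) ∷ (-2 ∷ -2 ∷ []) ∷ (1 ∷ 2 ∷ []) ∷ (-2 ∷ -2 ∷ []) ∷ (2 ∷ 2 ∷ []) ∷ (1 ∷ []) ∷ (-1 ∷ []) ∷ [])
    ∷ ([] ∷ [] ∷ (1 ∷ []) ∷ (-1 ∷ []) ∷ (1 ∷ []) ∷ (-1 ∷ []) ∷ [] ∷ [] ∷ [])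
    ∷ [])

  V₃ : Mat8 Pℤ.Poly
  V₃ = fromRows
    ( ([] ∷ (1 ∷ []) ∷ (1 ∷ []) ∷ (2 ∷ 2 ∷ []) ∷ (3 ∷ 1 ∷ []) ∷ (6 ∷ 7 ∷ 2 ∷ []) ∷ (2 ∷ 1 ∷ []) ∷ (4 ∷ 5 ∷ 2 ∷ []) ∷ [])
    ∷ ([] ∷ (2 ∷ []) ∷ (1 ∷ []) ∷ (1 ∷ 2 ∷ []) ∷ (3 ∷ 1 ∷ []) ∷ (6 ∷ 7 ∷ 2 ∷ []) ∷ (2 ∷ 1 ∷ []) ∷ (4 ∷ 5 ∷ 2 ∷ []) ∷ [])
    ∷ ([] ∷ (3 ∷ []) ∷ (2 ∷ []) ∷ (4 ∷ 4 ∷ []) ∷ (6 ∷ 2 ∷ []) ∷ (12 ∷ 13 ∷ 4 ∷ []) ∷ (4 ∷ 2 ∷ []) ∷ (8 ∷ 9 ∷ 4 ∷ []) ∷ [])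
    ∷ ([] ∷ (4 ∷ []) ∷ (3 ∷ []) ∷ (5 ∷ 6 ∷ []) ∷ (8 ∷ 3 ∷ []) ∷ (16 ∷ 19 ∷ 6 ∷ []) ∷ (5 ∷ 3 ∷ []) ∷ (10 ∷ 13 ∷ 6 ∷ []) ∷ [])
    ∷ ((1 ∷ []) ∷ (5 ∷ 2 ∷ []) ∷ (3 ∷ []) ∷ (5 ∷ 6 ∷ []) ∷ (8 ∷ 4 ∷ []) ∷ (17 ∷ 22 ∷ 8 ∷ []) ∷ (6 ∷ 4 ∷ []) ∷ (13 ∷ 18 ∷ 8 ∷ []) ∷ [])
    ∷ ((1 ∷ []) ∷ (4 ∷ 2 ∷ []) ∷ (2 ∷ []) ∷ (4 ∷ 4 ∷ []) ∷ (6 ∷ 3 ∷ []) ∷ (13 ∷ 16 ∷ 6 ∷ []) ∷ (5 ∷ 3 ∷ []) ∷ (10 ∷ 14 ∷ 6 ∷ []) ∷ [])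
    ∷ ((1 ∷ []) ∷ (4 ∷ 2 ∷ []) ∷ (1 ∷ []) ∷ (2 ∷ 2 ∷ []) ∷ (4 ∷ 2 ∷ []) ∷ (8 ∷ 10 ∷ 4 ∷ []) ∷ (4 ∷ 2 ∷ []) ∷ (8 ∷ 10 ∷ 4 ∷ []) ∷ [])
    ∷ ((1 ∷ []) ∷ (3 ∷ 2 ∷ []) ∷ [] ∷ [] ∷ (2 ∷ 1 ∷ []) ∷ (4 ∷ 5 ∷ 2 ∷ []) ∷ (2 ∷ 1 ∷ []) ∷ (4 ∷ 5 ∷ 2 ∷ []) ∷ [])
    ∷ [])

open Certificates

similar-when-s≡1[4] : ∀ m → SimilarToE8 (Setup.gramΛ (+ 1 ℤ.+ + 4 ℤ.* m))
similar-when-s≡1[4] m = similar-by-certificate U₁ V₁ refl refl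
  where open Symbolic (+ 1 ℤ.+ + 4 ℤ.* m) m (+ 1 ∷ + 4 ∷ []) (linear-eval (+ 1) (+ 4) m)

similar-when-s≡3[4] : ∀ m → SimilarToE8 (Setup.gramΛ (+ 3 ℤ.+ + 4 ℤ.* m))
similar-when-s≡3[4] m = similar-by-certificate U₃ V₃ refl refl
  where open Symbolic (+ 3 ℤ.+ + 4 ℤ.* m) m (+ 3 ∷ + 4 ∷ []) (linear-eval (+ 3) (+ 4) m)

similar-when-odd : ∀ s → Odd s → SimilarToE8 (Setup.gramΛ s)
similar-when-odd s (m , inj₁ s≡1+4m) =
  subst (λ s → SimilarToE8 (Setup.gramΛ s)) (sym s≡1+4m) (similar-when-s≡1[4] m)
similar-when-odd s (m , inj₂ s≡3+4m) =
  subst (λ s → SimilarToE8 (Setup.gramΛ s)) (sym s≡3+4m) (similar-when-s≡3[4] m)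

theorem4 : (s : ℤ) → SquareFree (Dof s) → Dof s % 4 ≡ 1 →
    SimilarToE8 (Setup.gramΛ s)
theorem4 s _ D≡1[4] = similar-when-odd s (D≡1[4]⇒odd s D≡1[4])
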